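{- Let $k\ge0$ and $n>0$ be integers. If $X\in T_{k,n}$, then $X\,(B^kB)^{(k+2)n}\in T_{k,n}$, i.e. the $\lambda$-term corresponding to $X$ applied to $(B^kB)^{(k+2)n}$ is $\beta\eta$-equivalent to the $\lambda$-term corresponding to some tree in $T_{k,n}$.
   Context: $B=\lambda f.\lambda g.\lambda x.\, f\,(g\,x)$; $e_1\circ e_2$ denotes $B\,e_1\,e_2$; $B^0B=B$, $B^{j+1}B=B\,(B^jB)$; for a $B$-term $e$ and $r\ge1$, $e^r$ denotes the $r$-fold composition $e\circ\cdots\circ e$. Binary trees are built from a leaf $\star$ and nodes $\langle t_1,t_2\rangle$; $\langle s_0,s_1,\dots,s_r\rangle$ abbreviates $\langle\cdots\langle\langle s_0,s_1\rangle,s_2\rangle\cdots,s_r\rangle$. A binary tree $t$ with $p$ leaves is identified with the $\lambda$-term $\lambda x_1.\cdots\lambda x_p.\,M$, where $M$ is $t$ read with nodes as application and leaves labelled $x_1,\dots,x_p$ from left to right (so $(B^kB)^{(k+2)n}$ corresponds to $\langle\star,\dots,\star,\langle\star,\star,\dots,\star\rangle\rangle$ with $k+1$ leading leaves and an inner tree with $(k+2)n+1$ leaves). Define $T'_{k,n}$ inductively: $\star\in T'_{k,n}$; and $\langle\star,s_1,\dots,s_{(k+2)n}\rangle\in T'_{k,n}$ whenever $s_i=\star$ for every $i$ that is a multiple of $k+2$ and $s_i\in T'_{k,n}$ for all other $i$. Let $T_{k,n}=\{\langle t_0,t_1,\dots,t_{k+1}\rangle \mid t_0,\dots,t_{k+1}\in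 T'_{k,n}\}$. -}

module Defs where

open import Data.Nat using (ℕ; zero; suc; _+_; _*_; _∸_; _<ᵇ_; _≡ᵇ_)
open import Data.Nat.Divisibility using (_∣_)
open import Data.Bool using (if_then_else_)
open import Data.List using (List; []; _∷_; length)
open import Data.List.Relation.Unary.All using (All)
open import Relation.Nullary using (¬_)
open import Relation.Binary.PropositionalEquality using (_≡_)

data Term : Set where
  var : ℕ → Term
  app : Term → Term → Term
  lam : Term → Term

shift : ℕ → ℕ → Term → Term
shift c d (var x) = if x <ᵇ c then var x else var (x + d)
shift c d (app t u) = app (shift c d t) (shift c d u)
shift c d (lam t) = lam (shift (suc c) d t)

subst : ℕ → Term → Term → Term
subst j s (var x) =
  if x ≡ᵇ j then s else (if j <ᵇ x then var (x ∸ 1) else var x)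
subst j s (app t u) = app (subst j s t) (subst j s u)
subst j s (lam t) = lam (subst (suc j) (shift 0 1 s) t)

infix 4 _≡βη_
data _≡βη_ : Term → Term → Set where
  β     : ∀ t u → app (lam t) u ≡βη subst 0 u t
  η     : ∀ t → lam (app (shift 0 1 t) (var 0)) ≡βη t
  refl  : ∀ {t} → t ≡βη t
  sym   : ∀ {t u} → t ≡βη u → u ≡βη t
  trans : ∀ {t u v} → t ≡βη u → u ≡βη v → t ≡βη v
  appL  : ∀ {t t′ u} → t ≡βη t′ → app t u ≡βη app t′ u
  appR  : ∀ {t u u′} → u ≡βη u′ → app t u ≡βη app t u′
  lamC  : ∀ {t t′} → t ≡βη t′ → lam t ≡βη lam t′

-- B = λf.λg.λx. f (g x)
B : Term
B = lam (lam (lam (app (var 2) (app (var 1) (var 0)))))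

_∘B_ : Term → Term → Term
e₁ ∘B e₂ = app (app B e₁) e₂

BjB : ℕ → Term
BjB zero = B
BjB (suc j) = app B (BjB j)

-- powB e r = e ∘ (e ∘ (... ∘ e)) with r copies of e, for r ≥ 1;
-- powB e 0 is set to e (never used: the statement only uses r ≥ 1)
powB : Term → ℕ → Term
powB e zero = e
powB e (suc zero) = e
powB e (suc (suc r)) = e ∘B powB e (suc r)

data Tree : Set where
  ⋆    : Tree
  node : Tree → Tree → Tree

leaves : Tree → ℕ
leaves ⋆ = 1
leaves (node t u) = leaves t + leaves u

-- body p i t : the body for t, whose leftmost leaf is the (i+1)-th leaf
-- (x_{i+1}) of a tree with p leaves; x_m is de Bruijn index p - m
body : ℕ → ℕ → Tree → Term
body p i ⋆ = var (p ∸ suc i)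
body p i (node t u) = app (body p i t) (body p (i + leaves t) u)

lams : ℕ → Term → Term
lams zero t = t
lams (suc m) t = lam (lams m t)

treeTerm : Tree → Term
treeTerm t = lams (leaves t) (body (leaves t) 0 t)

-- ⟨s₀, s₁, …, s_r⟩ = ⟨⋯⟨⟨s₀,s₁⟩,s₂⟩⋯,s_r⟩
spine : Tree → List Tree → Tree
spine t [] = t
spine t (s ∷ ss) = spine (node t s) ss

mutual
  data T′ (k n : ℕ) : Tree → Set where
    leaf : T′ k n ⋆
    nd   : ∀ {ss} → length ss ≡ (k + 2) * n → Args k n 1 ss →
           T′ k n (spine ⋆ ss)

  data Args (k n : ℕ) : ℕ → List Tree → Set where
    []    : ∀ {i} → Args k n i []
    star  : ∀ {i ss} → (k + 2) ∣ i → Args k n (suc i) ss →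
            Args k n i (⋆ ∷ ss)
    other : ∀ {i s ss} → ¬ ((k + 2) ∣ i) → T′ k n s → Args k n (suc i) ss →
            Args k n i (s ∷ ss)

data T (k n : ℕ) : Tree → Set where
  mk : ∀ {t₀} ts → T′ k n t₀ → length ts ≡ suc k → All (T′ k n) ts →
       T k n (spine t₀ ts)

-- Write X as a head leaf applied to its argument trees, X = ⟨⋆, u₁, …, uₘ⟩. Then X E
-- β-reduces to λx⃗. E U₁ … Uₘ, and η-expanding by d fresh variables gives the term of the tree
-- ⟨⋆, u₁, …, uₘ, ⋆, …, ⋆⟩ with E in head position. For E = (BᵏB)^r the composition law
-- (BᵏB)^r f a₁ … a_k g x₁ … x_r = f a₁ … a_k (g x₁ … x_r) regroups the arguments, so X E is the
-- term of ⟨v₁, …, v_{k+1}, ⟨v_{k+2}, …⟩⟩, where v₁, v₂, … is the padded list of (k+2)(n+1) trees.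
-- If t₀ = ⋆ we pad with (k+2)n + 1 leaves and the new last component is ⟨⋆, …, ⋆⟩. Otherwise
-- t₀ = ⟨⋆, s₁, …, s_{(k+2)n}⟩ with s_{k+2} = ⋆, we pad with a single leaf, and the new last
-- component ⟨⋆, s_{k+3}, …, s_{(k+2)n}, t₁, …, t_{k+1}, ⋆⟩ lies in T' because the slot condition
-- is invariant under shifting indices by k + 2, the tⱼ fall strictly between two multiples of
-- k + 2, and the final ⋆ falls on one.

module Submission where

open import Data.Bool using (true; false)
open import Data.Empty using (⊥-elim)
open import Data.List using (List; []; _∷_; _++_; length; map; replicate)
open import Data.List.Properties using (++-assoc; length-++; length-replicate)
open import Data.List.Relation.Unary.All using (All; []; _∷_)
open import Data.List.Relation.Unary.All.Properties using (++⁺)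
open import Data.Nat using (ℕ; zero; suc; _+_; _*_; _∸_; _<_; _≤_; _<ᵇ_; _≡ᵇ_; z≤n; s≤s; z<s)
open import Data.Nat.Divisibility using (_∣_; _∣?_; ∣-refl; ∣⇒≤; m∣m*n; ∣m+n∣m⇒∣n; ∣m∣n⇒∣m+n)
open import Data.Nat.Properties
open import Data.Nat.Tactic.RingSolver using (solve-∀)
open import Data.Product using (Σ; _×_; _,_; ∃₂)
open import Relation.Binary.Bundles using (Setoid)
import Relation.Binary.Reasoning.Setoid as SetoidReasoning
open import Relation.Binary.PropositionalEquality as ≡ using (_≡_; _≢_; cong; cong₂)
open import Relation.Nullary using (¬_; yes; no)

open import Defs

-- Substitution calculus

<ᵇ-true : ∀ {m n} → m < n → (m <ᵇ n) ≡ true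
<ᵇ-true {m} {n} m<n with m <ᵇ n | <⇒<ᵇ m<n
... | true | _ = ≡.refl

<ᵇ-false : ∀ {m n} → n ≤ m → (m <ᵇ n) ≡ false
<ᵇ-false {m} {n} n≤m with m <ᵇ n | <ᵇ⇒< m n
... | false | _ = ≡.refl
... | true | m<n = ⊥-elim (≤⇒≯ n≤m (m<n _))

≡ᵇ-refl : ∀ m → (m ≡ᵇ m) ≡ true
≡ᵇ-refl zero = ≡.refl
≡ᵇ-refl (suc m) = ≡ᵇ-refl m

≡ᵇ-false : ∀ {m n} → m ≢ n → (m ≡ᵇ n) ≡ false
≡ᵇ-false {m} {n} m≢n with m ≡ᵇ n | ≡ᵇ⇒≡ m n
... | false | _ = ≡.refl
... | true | m≡n = ⊥-elim (m≢n (m≡n _))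

shift-var-< : ∀ {c x} d → x < c → shift c d (var x) ≡ var x
shift-var-< d x<c rewrite <ᵇ-true x<c = ≡.refl

shift-var-≥ : ∀ {c x} d → c ≤ x → shift c d (var x) ≡ var (x + d)
shift-var-≥ d c≤x rewrite <ᵇ-false c≤x = ≡.refl

subst-var-≡ : ∀ j s → subst j s (var j) ≡ s
subst-var-≡ j s rewrite ≡ᵇ-refl j = ≡.refl

subst-var-< : ∀ {j x} s → x < j → subst j s (var x) ≡ var x
subst-var-< s x<j rewrite ≡ᵇ-false (<⇒≢ x<j) | <ᵇ-false (<⇒≤ x<j) = ≡.refl

subst-var-> : ∀ {j x} s → j < x → subst j s (var x) ≡ var (x ∸ 1)
subst-var-> s j<x rewrite ≡ᵇ-false (>⇒≢ j<x) | <ᵇ-true j<x = ≡.refl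

shift-+ : ∀ c a b t → shift c a (shift c b t) ≡ shift c (b + a) t
shift-+ c a b (var x) with x <? c
... | yes x<c rewrite shift-var-< b x<c | shift-var-< a x<c | shift-var-< (b + a) x<c = ≡.refl
... | no x≮c rewrite shift-var-≥ b (≮⇒≥ x≮c) | shift-var-≥ a (≤-trans (≮⇒≥ x≮c) (m≤m+n x b))
                   | shift-var-≥ (b + a) (≮⇒≥ x≮c) = cong var (+-assoc x b a)
shift-+ c a b (app t u) = cong₂ app (shift-+ c a b t) (shift-+ c a b u)
shift-+ c a b (lam t) = cong lam (shift-+ (suc c) a b t)

shift-zero : ∀ c t → shift c 0 t ≡ t
shift-zero c (var x) with x <? c
... | yes x<c = shift-var-< 0 x<c
... | no x≮c rewrite shift-var-≥ 0 (≮⇒≥ x≮c) = cong var (+-identityʳ x)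
shift-zero c (app t u) = cong₂ app (shift-zero c t) (shift-zero c u)
shift-zero c (lam t) = cong lam (shift-zero (suc c) t)

shift-comm : ∀ c a t → shift (suc c) a (shift c 1 t) ≡ shift c 1 (shift c a t)
shift-comm c a (var x) with x <? c
... | yes x<c rewrite shift-var-< 1 x<c | shift-var-< a x<c | shift-var-< a (m<n⇒m<1+n x<c)
                     | shift-var-< 1 x<c = ≡.refl
... | no x≮c rewrite shift-var-≥ 1 (≮⇒≥ x≮c) | +-comm x 1 | shift-var-≥ a (s≤s (≮⇒≥ x≮c))
                   | shift-var-≥ a (≮⇒≥ x≮c) | shift-var-≥ 1 (≤-trans (≮⇒≥ x≮c) (m≤m+n x a)) =
  cong var (≡.sym (+-comm (x + a) 1))
shift-comm c a (app t u) = cong₂ app (shift-comm c a t) (shift-comm c a u)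
shift-comm c a (lam t) = cong lam (shift-comm (suc c) a t)

subst-shift : ∀ c s t → subst c s (shift c 1 t) ≡ t
subst-shift c s (var x) with x <? c
... | yes x<c rewrite shift-var-< 1 x<c = subst-var-< s x<c
... | no x≮c rewrite shift-var-≥ 1 (≮⇒≥ x≮c) | +-comm x 1 = subst-var-> s (s≤s (≮⇒≥ x≮c))
subst-shift c s (app t u) = cong₂ app (subst-shift c s t) (subst-shift c s u)
subst-shift c s (lam t) = cong lam (subst-shift (suc c) (shift 0 1 s) t)

-- The composition law of BᵏB

≡⇒≡βη : ∀ {t u} → t ≡ u → t ≡βη u
≡⇒≡βη ≡.refl = refl

βη-setoid : Setoid _ _
βη-setoid = record
  { Carrier = Term
  ; _≈_ = _≡βη_
  ; isEquivalence = record { refl = refl ; sym = sym ; trans = trans }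
  }

module βη-Reasoning = SetoidReasoning βη-setoid

B-β : ∀ f g x → app (app (app B f) g) x ≡βη app f (app g x)
B-β f g x = trans (appL (appL (β _ f))) (trans (appL (β _ g)) (trans (β _ x) (≡⇒≡βη reduct)))
  where
  -- the residue of the three β-steps
  reduct : subst 0 x (app (subst 1 (shift 0 1 g) (shift 0 1 (shift 0 1 f))) (app (shift 0 1 g) (var 0)))
         ≡ app f (app g x)
  reduct rewrite ≡.sym (shift-comm 0 1 f) | subst-shift 1 (shift 0 1 g) (shift 0 1 f)
               | subst-shift 0 x f | subst-shift 0 x g = ≡.refl

Closed : Term → Set
Closed t = ∀ c d → shift c d t ≡ t

BjB-closed : ∀ k → Closed (BjB k)
BjB-closed zero c d = ≡.refl
BjB-closed (suc k) c d = cong (app B) (BjB-closed k c d)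

powB-closed : ∀ {e} → Closed e → ∀ r → Closed (powB e r)
powB-closed e-closed zero = e-closed
powB-closed e-closed (suc zero) = e-closed
powB-closed e-closed (suc (suc r)) c d = cong₂ _∘B_ (e-closed c d) (powB-closed e-closed (suc r) c d)

apps : Term → List Term → Term
apps h [] = h
apps h (a ∷ as) = apps (app h a) as

apps-++ : ∀ h xs ys → apps h (xs ++ ys) ≡ apps (apps h xs) ys
apps-++ h [] ys = ≡.refl
apps-++ h (x ∷ xs) ys = apps-++ (app h x) xs ys

apps-congˡ : ∀ {h h′} as → h ≡βη h′ → apps h as ≡βη apps h′ as
apps-congˡ [] h≈h′ = h≈h′
apps-congˡ (a ∷ as) h≈h′ = apps-congˡ as (appL h≈h′)

shift-apps : ∀ c d h as → shift c d (apps h as) ≡ apps (shift c d h) (map (shift c d) as)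
shift-apps c d h [] = ≡.refl
shift-apps c d h (a ∷ as) = shift-apps c d (app h a) as

subst-apps : ∀ j s h as → subst j s (apps h as) ≡ apps (subst j s h) (map (subst j s) as)
subst-apps j s h [] = ≡.refl
subst-apps j s h (a ∷ as) = subst-apps j s (app h a) as

BjB-apps : ∀ k f as g x → length as ≡ k →
  apps (BjB k) (f ∷ as ++ g ∷ x ∷ []) ≡βη apps f (as ++ app g x ∷ [])
BjB-apps zero f [] g x ≡.refl = B-β f g x
BjB-apps (suc k) f (a ∷ as) g x ≡.refl =
  trans (apps-congˡ (as ++ g ∷ x ∷ []) (B-β (BjB k) f a)) (BjB-apps k (app f a) as g x ≡.refl)

powB-apps : ∀ k r f as g xs → length as ≡ k → length xs ≡ suc r →
  apps (powB (BjB k) (suc r)) (f ∷ as ++ g ∷ xs) ≡βη apps f (as ++ apps g xs ∷ [])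
powB-apps k zero f as g (x ∷ []) |as| _ = BjB-apps k f as g x |as|
powB-apps k (suc r) f as g (x ∷ y ∷ ys) |as| |xs| = begin
  apps (app (app (app B (BjB k)) P) f) (as ++ g ∷ x ∷ y ∷ ys)
    ≈⟨ apps-congˡ (as ++ g ∷ x ∷ y ∷ ys) (B-β (BjB k) P f) ⟩
  apps (app (BjB k) (app P f)) (as ++ g ∷ x ∷ y ∷ ys)
    ≡⟨ cong (apps (app (BjB k) (app P f))) (++-assoc as (g ∷ x ∷ []) (y ∷ ys)) ⟨
  apps (app (BjB k) (app P f)) ((as ++ g ∷ x ∷ []) ++ y ∷ ys)
    ≡⟨ apps-++ (app (BjB k) (app P f)) (as ++ g ∷ x ∷ []) (y ∷ ys) ⟩
  apps (apps (BjB k) (app P f ∷ as ++ g ∷ x ∷ [])) (y ∷ ys)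
    ≈⟨ apps-congˡ (y ∷ ys) (BjB-apps k (app P f) as g x |as|) ⟩
  apps (apps (app P f) (as ++ app g x ∷ [])) (y ∷ ys)
    ≡⟨ apps-++ (app P f) (as ++ app g x ∷ []) (y ∷ ys) ⟨
  apps (app P f) ((as ++ app g x ∷ []) ++ y ∷ ys)
    ≡⟨ cong (apps (app P f)) (++-assoc as (app g x ∷ []) (y ∷ ys)) ⟩
  apps P (f ∷ as ++ app g x ∷ y ∷ ys)
    ≈⟨ powB-apps k r f as (app g x) (y ∷ ys) |as| (suc-injective |xs|) ⟩
  apps f (as ++ apps g (x ∷ y ∷ ys) ∷ []) ∎
  where
  open βη-Reasoning
  P = powB (BjB k) (suc r)

-- λ-terms of spines

lams-+ : ∀ a b M → lams a (lams b M) ≡ lams (a + b) M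
lams-+ zero b M = ≡.refl
lams-+ (suc a) b M = cong lam (lams-+ a b M)

lams-cong : ∀ p {M N} → M ≡βη N → lams p M ≡βη lams p N
lams-cong zero M≈N = M≈N
lams-cong (suc p) M≈N = lamC (lams-cong p M≈N)

subst-lams : ∀ {E} → Closed E → ∀ p j M → subst j E (lams p M) ≡ lams p (subst (p + j) E M)
subst-lams E-closed zero j M = ≡.refl
subst-lams E-closed (suc p) j M
  rewrite E-closed 0 1 | subst-lams E-closed p (suc j) M | +-suc p j = ≡.refl

vars : ℕ → List Term
vars zero = []
vars (suc d) = var d ∷ vars d

η-expand : ∀ d F → F ≡βη lams d (apps (shift 0 d F) (vars d))
η-expand zero F = ≡⇒≡βη (≡.sym (shift-zero 0 F))
η-expand (suc d) F = trans (sym (η F))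
  (lamC (trans (η-expand d F′) (≡⇒≡βη (cong (λ h → lams d (apps h (vars d))) shifted))))
  where
  F′ = app (shift 0 1 F) (var 0)
  shifted : shift 0 d F′ ≡ app (shift 0 (suc d) F) (var d)
  shifted = cong₂ app (shift-+ 0 d 1 F) (shift-var-≥ d z≤n)

sumLeaves : List Tree → ℕ
sumLeaves [] = 0
sumLeaves (t ∷ ts) = leaves t + sumLeaves ts

sumLeaves-++ : ∀ xs ys → sumLeaves (xs ++ ys) ≡ sumLeaves xs + sumLeaves ys
sumLeaves-++ [] ys = ≡.refl
sumLeaves-++ (x ∷ xs) ys
  rewrite sumLeaves-++ xs ys = ≡.sym (+-assoc (leaves x) (sumLeaves xs) (sumLeaves ys))

sumLeaves-replicate-⋆ : ∀ r → sumLeaves (replicate r ⋆) ≡ r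
sumLeaves-replicate-⋆ zero = ≡.refl
sumLeaves-replicate-⋆ (suc r) = cong suc (sumLeaves-replicate-⋆ r)

spine-++ : ∀ t xs ys → spine t (xs ++ ys) ≡ spine (spine t xs) ys
spine-++ t [] ys = ≡.refl
spine-++ t (x ∷ xs) ys = spine-++ (node t x) xs ys

leaves-spine : ∀ t ss → leaves (spine t ss) ≡ leaves t + sumLeaves ss
leaves-spine t [] = ≡.sym (+-identityʳ (leaves t))
leaves-spine t (s ∷ ss)
  rewrite leaves-spine (node t s) ss = +-assoc (leaves t) (leaves s) (sumLeaves ss)

bodies : ℕ → ℕ → List Tree → List Term
bodies p i [] = []
bodies p i (s ∷ ss) = body p i s ∷ bodies p (i + leaves s) ss

length-bodies : ∀ p i ss → length (bodies p i ss) ≡ length ss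
length-bodies p i [] = ≡.refl
length-bodies p i (s ∷ ss) = cong suc (length-bodies p (i + leaves s) ss)

bodies-++ : ∀ p i xs ys → bodies p i (xs ++ ys) ≡ bodies p i xs ++ bodies p (i + sumLeaves xs) ys
bodies-++ p i [] ys rewrite +-identityʳ i = ≡.refl
bodies-++ p i (x ∷ xs) ys
  rewrite bodies-++ p (i + leaves x) xs ys | +-assoc i (leaves x) (sumLeaves xs) = ≡.refl

body-spine : ∀ p i t ss → body p i (spine t ss) ≡ apps (body p i t) (bodies p (i + leaves t) ss)
body-spine p i t [] = ≡.refl
body-spine p i t (s ∷ ss)
  rewrite body-spine p i (node t s) ss | +-assoc i (leaves t) (leaves s) = ≡.refl

body-suc : ∀ p i t → body (suc p) (suc i) t ≡ body p i t
body-suc p i ⋆ = ≡.refl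
body-suc p i (node t u) = cong₂ app (body-suc p i t) (body-suc p (i + leaves t) u)

bodies-suc : ∀ p i ss → bodies (suc p) (suc i) ss ≡ bodies p i ss
bodies-suc p i [] = ≡.refl
bodies-suc p i (s ∷ ss) = cong₂ _∷_ (body-suc p i s) (bodies-suc p (i + leaves s) ss)

bodies-replicate-⋆ : ∀ p i r → p ≡ i + r → bodies p i (replicate r ⋆) ≡ vars r
bodies-replicate-⋆ p i zero _ = ≡.refl
bodies-replicate-⋆ p i (suc r) ≡.refl = cong₂ _∷_
  (cong var (≡.trans (cong (_∸ suc i) (+-suc i r)) (m+n∸m≡n (suc i) r)))
  (bodies-replicate-⋆ (i + suc r) (i + 1) r (≡.trans (+-suc i r) (cong (_+ r) (+-comm 1 i))))

≤-split : ∀ i a b {p} → i + (a + b) ≤ p → i + a ≤ p × i + a + b ≤ p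
≤-split i a b {p} i+a+b≤p =
  ≤-trans (+-monoʳ-≤ i (m≤m+n a b)) i+a+b≤p , ≡.subst (_≤ p) (≡.sym (+-assoc i a b)) i+a+b≤p

subst-body : ∀ j s i t → i + leaves t ≤ j → subst j s (body j i t) ≡ body j i t
subst-body j s i ⋆ i+1≤j = subst-var-< s (∸-monoʳ-< z<s (≡.subst (_≤ j) (+-comm i 1) i+1≤j))
subst-body j s i (node t u) bound with ≤-split i (leaves t) (leaves u) bound
... | bound-t , bound-u = cong₂ app (subst-body j s i t bound-t) (subst-body j s (i + leaves t) u bound-u)

shift-body : ∀ d p i t → i + leaves t ≤ p → shift 0 d (body p i t) ≡ body (p + d) i t
shift-body d p i ⋆ i+1≤p = cong var (≡.sym (+-∸-comm d (≡.subst (_≤ p) (+-comm i 1) i+1≤p)))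
shift-body d p i (node t u) bound with ≤-split i (leaves t) (leaves u) bound
... | bound-t , bound-u = cong₂ app (shift-body d p i t bound-t) (shift-body d p (i + leaves t) u bound-u)

map-bodies : ∀ (f : Term → Term) p p′ →
  (∀ i t → i + leaves t ≤ p → f (body p i t) ≡ body p′ i t) →
  ∀ i ss → i + sumLeaves ss ≤ p → map f (bodies p i ss) ≡ bodies p′ i ss
map-bodies f p p′ f-body i [] _ = ≡.refl
map-bodies f p p′ f-body i (s ∷ ss) bound with ≤-split i (leaves s) (sumLeaves ss) bound
... | bound-s , bound-ss = cong₂ _∷_ (f-body i s bound-s) (map-bodies f p p′ f-body (i + leaves s) ss bound-ss)

treeTerm-spine⋆ : ∀ ss → let p = sumLeaves ss in
  treeTerm (spine ⋆ ss) ≡ lam (lams p (apps (var p) (bodies p 0 ss)))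
treeTerm-spine⋆ ss rewrite leaves-spine ⋆ ss | body-spine (suc (sumLeaves ss)) 0 ⋆ ss
                         | bodies-suc (sumLeaves ss) 0 ss = ≡.refl

β-spine⋆ : ∀ ss {E} → Closed E → let p = sumLeaves ss in
  app (treeTerm (spine ⋆ ss)) E ≡βη lams p (apps E (bodies p 0 ss))
β-spine⋆ ss {E} E-closed rewrite treeTerm-spine⋆ ss = trans (β _ E) (≡⇒≡βη (begin
  subst 0 E (lams p (apps (var p) (bodies p 0 ss)))
    ≡⟨ subst-lams E-closed p 0 _ ⟩
  lams p (subst (p + 0) E (apps (var p) (bodies p 0 ss)))
    ≡⟨ cong (λ j → lams p (subst j E (apps (var p) (bodies p 0 ss)))) (+-identityʳ p) ⟩
  lams p (subst p E (apps (var p) (bodies p 0 ss)))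
    ≡⟨ cong (lams p) (subst-apps p E (var p) (bodies p 0 ss)) ⟩
  lams p (apps (subst p E (var p)) (map (subst p E) (bodies p 0 ss)))
    ≡⟨ cong₂ (λ h as → lams p (apps h as)) (subst-var-≡ p E)
             (map-bodies (subst p E) p p (subst-body p E) 0 ss ≤-refl) ⟩
  lams p (apps E (bodies p 0 ss)) ∎))
  where
  open ≡.≡-Reasoning
  p = sumLeaves ss

η-pad : ∀ ss {E} → Closed E → ∀ d → let p = sumLeaves ss in
  lams p (apps E (bodies p 0 ss)) ≡βη lams (p + d) (apps E (bodies (p + d) 0 (ss ++ replicate d ⋆)))
η-pad ss {E} E-closed d = begin
  lams p (apps E (bodies p 0 ss))
    ≈⟨ lams-cong p (η-expand d (apps E (bodies p 0 ss))) ⟩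
  lams p (lams d (apps (shift 0 d (apps E (bodies p 0 ss))) (vars d)))
    ≡⟨ lams-+ p d _ ⟩
  lams (p + d) (apps (shift 0 d (apps E (bodies p 0 ss))) (vars d))
    ≡⟨ cong (λ h → lams (p + d) (apps h (vars d))) (shift-apps 0 d E (bodies p 0 ss)) ⟩
  lams (p + d) (apps (apps (shift 0 d E) (map (shift 0 d) (bodies p 0 ss))) (vars d))
    ≡⟨ cong₂ (λ h as → lams (p + d) (apps (apps h as) (vars d))) (E-closed 0 d)
             (map-bodies (shift 0 d) p (p + d) (shift-body d p) 0 ss ≤-refl) ⟩
  lams (p + d) (apps (apps E (bodies (p + d) 0 ss)) (vars d))
    ≡⟨ cong (lams (p + d)) (apps-++ E (bodies (p + d) 0 ss) (vars d)) ⟨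
  lams (p + d) (apps E (bodies (p + d) 0 ss ++ vars d))
    ≡⟨ cong (λ as → lams (p + d) (apps E (bodies (p + d) 0 ss ++ as)))
            (bodies-replicate-⋆ (p + d) p d ≡.refl) ⟨
  lams (p + d) (apps E (bodies (p + d) 0 ss ++ bodies (p + d) p (replicate d ⋆)))
    ≡⟨ cong (λ as → lams (p + d) (apps E as)) (bodies-++ (p + d) 0 ss (replicate d ⋆)) ⟨
  lams (p + d) (apps E (bodies (p + d) 0 (ss ++ replicate d ⋆))) ∎
  where
  open βη-Reasoning
  p = sumLeaves ss

leaves-regroup : ∀ f as g xs →
  leaves (spine f (as ++ spine g xs ∷ [])) ≡ sumLeaves (f ∷ as ++ g ∷ xs)
leaves-regroup f as g xs
  rewrite leaves-spine f (as ++ spine g xs ∷ []) | sumLeaves-++ as (spine g xs ∷ [])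
        | sumLeaves-++ as (g ∷ xs) | +-identityʳ (leaves (spine g xs)) | leaves-spine g xs = ≡.refl

body-regroup : ∀ p f as g xs → let j = leaves f + sumLeaves as in
  body p 0 (spine f (as ++ spine g xs ∷ []))
    ≡ apps (body p 0 f) (bodies p (leaves f) as ++ apps (body p j g) (bodies p (j + leaves g) xs) ∷ [])
body-regroup p f as g xs
  rewrite body-spine p 0 f (as ++ spine g xs ∷ []) | bodies-++ p (leaves f) as (spine g xs ∷ [])
        | body-spine p (leaves f + sumLeaves as) g xs = ≡.refl

spine⋆-powB : ∀ k r ss d f as g xs → length as ≡ k → length xs ≡ suc r →
  ss ++ replicate d ⋆ ≡ f ∷ as ++ g ∷ xs →
  app (treeTerm (spine ⋆ ss)) (powB (BjB k) (suc r)) ≡βη treeTerm (spine f (as ++ spine g xs ∷ []))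
spine⋆-powB k r ss d f as g xs |as| |xs| padded = begin
  app (treeTerm (spine ⋆ ss)) E
    ≈⟨ β-spine⋆ ss E-closed ⟩
  lams p (apps E (bodies p 0 ss))
    ≈⟨ η-pad ss E-closed d ⟩
  lams q (apps E (bodies q 0 (ss ++ replicate d ⋆)))
    ≡⟨ cong (λ ts → lams q (apps E (bodies q 0 ts))) padded ⟩
  lams q (apps E (bodies q 0 (f ∷ as ++ g ∷ xs)))
    ≡⟨ cong (λ bs → lams q (apps E (body q 0 f ∷ bs))) (bodies-++ q (leaves f) as (g ∷ xs)) ⟩
  lams q (apps E (body q 0 f ∷ bodies q (leaves f) as ++ body q j g ∷ bodies q (j + leaves g) xs))
    ≈⟨ lams-cong q (powB-apps k r (body q 0 f) (bodies q (leaves f) as) (body q j g)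
                      (bodies q (j + leaves g) xs)
                      (≡.trans (length-bodies q (leaves f) as) |as|)
                      (≡.trans (length-bodies q (j + leaves g) xs) |xs|)) ⟩
  lams q (apps (body q 0 f) (bodies q (leaves f) as ++ apps (body q j g) (bodies q (j + leaves g) xs) ∷ []))
    ≡⟨ cong (lams q) (body-regroup q f as g xs) ⟨
  lams q (body q 0 Y)
    ≡⟨ cong (λ l → lams l (body l 0 Y)) leaves-Y ⟨
  treeTerm Y ∎
  where
  open βη-Reasoning
  E = powB (BjB k) (suc r)
  E-closed = powB-closed (BjB-closed k) (suc r)
  p = sumLeaves ss
  q = p + d
  j = leaves f + sumLeaves as
  Y = spine f (as ++ spine g xs ∷ [])
  leaves-Y : leaves Y ≡ q
  leaves-Y = ≡.trans (leaves-regroup f as g xs) (≡.trans (cong sumLeaves (≡.sym padded))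
               (≡.trans (sumLeaves-++ ss (replicate d ⋆)) (cong (p +_) (sumLeaves-replicate-⋆ d))))

-- The slot condition

module _ {k n : ℕ} where

  Args-reindex : ∀ {i j xs} → i ≡ j → Args k n i xs → Args k n j xs
  Args-reindex ≡.refl args = args

  Args-++⁻ : ∀ {i} xs {ys} → Args k n i (xs ++ ys) → Args k n i xs × Args k n (i + length xs) ys
  Args-++⁻ {i} [] args = [] , Args-reindex (≡.sym (+-identityʳ i)) args
  Args-++⁻ {i} (x ∷ xs) (star d args) with Args-++⁻ xs args
  ... | args-xs , args-ys = star d args-xs , Args-reindex (≡.sym (+-suc i _)) args-ys
  Args-++⁻ {i} (x ∷ xs) (other d t args) with Args-++⁻ xs args
  ... | args-xs , args-ys = other d t args-xs , Args-reindex (≡.sym (+-suc i _)) args-ys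

  Args-++⁺ : ∀ {i} xs {ys} → Args k n i xs → Args k n (i + length xs) ys → Args k n i (xs ++ ys)
  Args-++⁺ {i} [] [] args-ys = Args-reindex (+-identityʳ i) args-ys
  Args-++⁺ {i} (x ∷ xs) (star d args-xs) args-ys =
    star d (Args-++⁺ xs args-xs (Args-reindex (+-suc i _) args-ys))
  Args-++⁺ {i} (x ∷ xs) (other d t args-xs) args-ys =
    other d t (Args-++⁺ xs args-xs (Args-reindex (+-suc i _) args-ys))

  Args⇒All : ∀ {i xs} → Args k n i xs → All (T′ k n) xs
  Args⇒All [] = []
  Args⇒All (star _ args) = leaf ∷ Args⇒All args
  Args⇒All (other _ t args) = t ∷ Args⇒All args

  Args-tail : ∀ {i x xs} → Args k n i (x ∷ xs) → Args k n (suc i) xs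
  Args-tail (star _ args) = args
  Args-tail (other _ _ args) = args

  Args-∣⇒⋆ : ∀ {i x xs} → (k + 2) ∣ i → Args k n i (x ∷ xs) → x ≡ ⋆
  Args-∣⇒⋆ _ (star _ _) = ≡.refl
  Args-∣⇒⋆ d (other ∤ _ _) = ⊥-elim (∤ d)

  Args-period : ∀ {i xs} → Args k n (i + (k + 2)) xs → Args k n i xs
  Args-period [] = []
  Args-period {i} (star d args) =
    star (∣m+n∣m⇒∣n (≡.subst ((k + 2) ∣_) (+-comm i (k + 2)) d) ∣-refl) (Args-period args)
  Args-period (other ∤ t args) = other (λ d → ∤ (∣m∣n⇒∣m+n d ∣-refl)) t (Args-period args)

  Args-⋆∷ : ∀ {i xs} → Args k n (suc i) xs → Args k n i (⋆ ∷ xs)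
  Args-⋆∷ {i} args with (k + 2) ∣? i
  ... | yes d = star d args
  ... | no ∤ = other ∤ leaf args

  Args-replicate-⋆ : ∀ i r → Args k n i (replicate r ⋆)
  Args-replicate-⋆ i zero = []
  Args-replicate-⋆ i (suc r) = Args-⋆∷ (Args-replicate-⋆ (suc i) r)

  Args-between-multiples : ∀ a b ts → All (T′ k n) ts → b + length ts ≤ suc k →
    Args k n (suc b + (k + 2) * a) ts
  Args-between-multiples a b [] [] _ = []
  Args-between-multiples a b (t ∷ ts) (t∈T′ ∷ ts∈T′) bound =
    other ∤ t∈T′ (Args-between-multiples a (suc b) ts ts∈T′ (≡.subst (_≤ suc k) (+-suc b _) bound))
    where
    ∤ : ¬ (k + 2) ∣ suc b + (k + 2) * a
    ∤ d = 1+n≰n (≡.subst (_≤ suc k) (+-comm k 2) (≤-trans (∣⇒≤ d′) (≤-trans (m≤m+n (suc b) _) bound′)))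
      where
      d′ : (k + 2) ∣ suc b
      d′ = ∣m+n∣m⇒∣n (≡.subst ((k + 2) ∣_) (+-comm (suc b) _) d) (m∣m*n a)
      bound′ : suc b + length ts ≤ suc k
      bound′ = ≡.subst (_≤ suc k) (+-suc b _) bound

  Args-first-block : ∀ {s as y ss} → length as ≡ k → Args k n 1 (s ∷ as ++ y ∷ ss) →
    All (T′ k n) (s ∷ as) × y ≡ ⋆ × Args k n 1 ss
  Args-first-block {s} {as} |as| args with Args-++⁻ (s ∷ as) args
  ... | args-sas , args-yss =
    Args⇒All args-sas , Args-∣⇒⋆ ∣-refl args-yss′ , Args-period {1} (Args-tail args-yss′)
    where
    args-yss′ = Args-reindex (≡.trans (cong (2 +_) |as|) (+-comm 2 k)) args-yss

split-length : ∀ {A : Set} a {b} (xs : List A) → length xs ≡ a + b →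
  ∃₂ λ ys zs → xs ≡ ys ++ zs × length ys ≡ a × length zs ≡ b
split-length zero xs |xs| = [] , xs , ≡.refl , ≡.refl , |xs|
split-length (suc a) (x ∷ xs) |xs| with split-length a xs (suc-injective |xs|)
... | ys , zs , ≡.refl , |ys| , |zs| = x ∷ ys , zs , ≡.refl , cong suc |ys| , |zs|

-- shaped for splitting an argument list into s₁, the next k arguments, and the rest
blocks-suc : ∀ k m → (k + 2) * suc m ≡ suc (k + suc ((k + 2) * m))
blocks-suc = solve-∀

length-rotated : ∀ {k m} ss ts → length ss ≡ (k + 2) * m → length ts ≡ suc k →
  length (ss ++ ts ++ ⋆ ∷ []) ≡ (k + 2) * suc m
length-rotated {k} {m} ss ts |ss| |ts|
  rewrite length-++ ss {ts ++ ⋆ ∷ []} | length-++ ts {⋆ ∷ []} | |ss| | |ts| = arithmetic k m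
  where
  arithmetic : ∀ k m → (k + 2) * m + (suc k + 1) ≡ (k + 2) * suc m
  arithmetic = solve-∀

rotated-T′ : ∀ {k m ss ts} → length ss ≡ (k + 2) * m → Args k (suc m) 1 ss →
  length ts ≡ suc k → All (T′ k (suc m)) ts → T′ k (suc m) (spine ⋆ (ss ++ ts ++ ⋆ ∷ []))
rotated-T′ {k} {m} {ss} {ts} |ss| args-ss |ts| ts∈T′ =
  nd (length-rotated ss ts |ss| |ts|) (Args-++⁺ ss args-ss (Args-++⁺ ts args-ts (Args-⋆∷ [])))
  where
  args-ts : Args k (suc m) (1 + length ss) ts
  args-ts = Args-reindex (cong suc (≡.sym |ss|)) (Args-between-multiples m 0 ts ts∈T′ (≤-reflexive |ts|))

AppPowB∈T : ℕ → ℕ → Tree → Set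
AppPowB∈T k n X = Σ Tree λ Y → T k n Y × app (treeTerm X) (powB (BjB k) ((k + 2) * n)) ≡βη treeTerm Y

AppPowB∈T-regroup : ∀ {k m} ss d f as g xs → length as ≡ k → length xs ≡ (k + 2) * suc m →
  ss ++ replicate d ⋆ ≡ f ∷ as ++ g ∷ xs →
  T′ k (suc m) f → All (T′ k (suc m)) as → T′ k (suc m) (spine g xs) →
  AppPowB∈T k (suc m) (spine ⋆ ss)
AppPowB∈T-regroup {k} {m} ss d f as g xs |as| |xs| padded f∈T′ as∈T′ W∈T′ =
  spine f (as ++ W ∷ []) ,
  mk (as ++ W ∷ []) f∈T′ (≡.trans (length-++ as) (≡.trans (+-comm (length as) 1) (cong suc |as|)))
     (++⁺ as∈T′ (W∈T′ ∷ [])) ,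
  ≡.subst (λ e → app (treeTerm (spine ⋆ ss)) (powB (BjB k) e) ≡βη treeTerm (spine f (as ++ W ∷ [])))
    (≡.sym (blocks-suc k m))
    (spine⋆-powB k _ ss d f as g xs |as| (≡.trans |xs| (blocks-suc k m)) padded)
  where
  W = spine g xs

leaf-head : ∀ {k m} t ts → T′ k (suc m) t → All (T′ k (suc m)) ts → length ts ≡ k →
  AppPowB∈T k (suc m) (spine ⋆ (t ∷ ts))
leaf-head {k} {m} t ts t∈T′ ts∈T′ |ts| =
  AppPowB∈T-regroup (t ∷ ts) (suc N) t ts ⋆ (replicate N ⋆) |ts| (length-replicate N) ≡.refl
    t∈T′ ts∈T′ (nd (length-replicate N) (Args-replicate-⋆ 1 N))
  where
  N = (k + 2) * suc m

node-head : ∀ {k m} ss ts → length ss ≡ (k + 2) * suc m → Args k (suc m) 1 ss →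
  length ts ≡ suc k → All (T′ k (suc m)) ts → AppPowB∈T k (suc m) (spine (spine ⋆ ss) ts)
node-head {k} {m} [] ts |ss| _ _ _ with () ← ≡.trans |ss| (blocks-suc k m)
node-head {k} {m} (s ∷ rest) ts |ss| args |ts| ts∈T′
  with split-length k rest (suc-injective (≡.trans |ss| (blocks-suc k m)))
... | as , y ∷ ss′ , ≡.refl , |as| , |yss′| with Args-first-block |as| args
... | s∈T′ ∷ as∈T′ , ≡.refl , args-ss′ =
  ≡.subst (AppPowB∈T k (suc m)) (spine-++ ⋆ (s ∷ as ++ ⋆ ∷ ss′) ts)
    (AppPowB∈T-regroup ((s ∷ as ++ ⋆ ∷ ss′) ++ ts) 1 s as ⋆ (ss′ ++ ts ++ ⋆ ∷ [])
      |as| (length-rotated ss′ ts |ss′| |ts|) padded s∈T′ as∈T′ (rotated-T′ |ss′| args-ss′ |ts| ts∈T′))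
  where
  |ss′| = suc-injective |yss′|
  padded : ((s ∷ as ++ ⋆ ∷ ss′) ++ ts) ++ ⋆ ∷ [] ≡ s ∷ as ++ ⋆ ∷ ss′ ++ ts ++ ⋆ ∷ []
  padded = ≡.trans (++-assoc (s ∷ as ++ ⋆ ∷ ss′) ts (⋆ ∷ [])) (cong (s ∷_) (++-assoc as (⋆ ∷ ss′) (ts ++ ⋆ ∷ [])))

lemma3p9 : (k n : ℕ) → 0 < n → (X : Tree) → T k n X →
    Σ Tree (λ Y → T k n Y × (app (treeTerm X) (powB (BjB k) ((k + 2) * n)) ≡βη treeTerm Y))
lemma3p9 k zero () _ _
lemma3p9 k (suc m) _ .(spine ⋆ (t ∷ ts)) (mk (t ∷ ts) leaf |tts| (t∈T′ ∷ ts∈T′)) =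
  leaf-head t ts t∈T′ ts∈T′ (suc-injective |tts|)
lemma3p9 k (suc m) _ .(spine (spine ⋆ ss) ts) (mk ts (nd {ss} |ss| args) |ts| ts∈T′) =
  node-head ss ts |ss| args |ts| ts∈T′
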